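{- Let $k\ge 1$ and let $F_3$ be the graph consisting of a clique $K$ with $k$ vertices and three further vertices $s,y,w$, where $s$ and $y$ are adjacent to every vertex of $K$, $w$ is adjacent only to $y$, and there are no other edges besides those inside $K$. Consider the greedy coloring game on $F_3$ with color set $\{1,\dots,k+1\}$ in which Bob moves first, and suppose Bob's first move colors $s$. Then Alice has a winning strategy if her first move colors $y$, and if her first move colors any other vertex then Bob has a winning strategy.
   Context: Greedy coloring game: given a finite graph and a color set $C=\{1,\dots,k\}$, Alice and Bob alternate turns; on a turn the player chooses an uncolored vertex and it receives the least integer of $C$ not already assigned to any of its colored neighbors. Alice wins if all vertices get colored; otherwise (some uncolored vertex has all colors of $C$ on its neighbors) Bob wins. -}

module Defs where

open import Data.Nat using (ℕ; _≤_; _<_)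
open import Data.Fin using (Fin)
open import Data.Maybe using (Maybe; just; nothing)
open import Data.Product using (Σ; _×_)
open import Data.Unit using (⊤)
open import Data.Empty using (⊥)
open import Relation.Nullary using (¬_)
open import Relation.Binary.PropositionalEquality using (_≡_)

Coloring : Set → Set
Coloring V = V → Maybe ℕ

module Game {V : Set} (Adj : V → V → Set) (K : ℕ) where

  Used : Coloring V → V → ℕ → Set
  Used col v c = Σ V λ u → Adj u v × col u ≡ just c

  Blocked : Coloring V → V → Set
  Blocked col v = col v ≡ nothing × (∀ c → 1 ≤ c → c ≤ K → Used col v c)

  BobWon : Coloring V → Set
  BobWon col = Σ V λ v → Blocked col v

  AllColored : Coloring V → Set
  AllColored col = ∀ v → ¬ col v ≡ nothing

  LeastFree : Coloring V → V → ℕ → Set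
  LeastFree col v c =
    1 ≤ c × c ≤ K × ¬ Used col v c × (∀ c' → 1 ≤ c' → c' < c → Used col v c')

  Move : Coloring V → V → Coloring V → Set
  Move col v col' =
    col v ≡ nothing ×
    Σ ℕ (λ c → LeastFree col v c × col' v ≡ just c × (∀ u → ¬ u ≡ v → col' u ≡ col u))

  data Player : Set where
    alice bob : Player

  data AliceWins (col : Coloring V) : Player → Set where
    a-done  : ∀ {p} → AllColored col → AliceWins col p
    a-alice : ¬ BobWon col →
              Σ V (λ v → Σ (Coloring V) λ col' → Move col v col' × AliceWins col' bob) →
              AliceWins col alice
    a-bob   : ¬ BobWon col →
              (∀ v col' → Move col v col' → AliceWins col' alice) →
              AliceWins col bob

  data BobWins (col : Coloring V) : Player → Set where
    b-done  : ∀ {p} → BobWon col → BobWins col p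
    b-bob   : ¬ AllColored col →
              Σ V (λ v → Σ (Coloring V) λ col' → Move col v col' × BobWins col' alice) →
              BobWins col bob
    b-alice : ¬ AllColored col →
              (∀ v col' → Move col v col' → BobWins col' bob) →
              BobWins col alice

  empty : Coloring V
  empty _ = nothing

data F3V (k : ℕ) : Set where
  clq : Fin k → F3V k
  s y w : F3V k

F3Adj : (k : ℕ) → F3V k → F3V k → Set
F3Adj k (clq i) (clq j) = ¬ i ≡ j
F3Adj k (clq i) s = ⊤
F3Adj k s (clq i) = ⊤
F3Adj k (clq i) y = ⊤
F3Adj k y (clq i) = ⊤
F3Adj k y w = ⊤
F3Adj k w y = ⊤
F3Adj k _ _ = ⊥

module Submission where

-- Both halves are invariant arguments.  For any finite simple graph we show that a
-- property of colourings which is preserved by every move, and which rules out Bob's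
-- (resp. Alice's) win, wins the game for Alice (resp. Bob) whoever moves: the player
-- simply makes any legal move, and the game ends because each move colours a vertex.
--
--  * Alice answers y: y gets colour 1 too.  While s and y both carry colour 1, w can
--    never be blocked (colour 2 is free for it), and a clique vertex cannot be blocked
--    either: the colours 2,…,k+1 would need k distinct clique vertices besides itself.
--  * Alice answers w, or a clique vertex (after which Bob colours w): now s and w carry
--    colour 1.  Then y together with the clique is a (k+1)-clique whose colours avoid 1,
--    so it can never be fully coloured with the k colours 2,…,k+1.

open import Data.Nat using (ℕ; zero; suc; _+_; _≤_; _<_; z≤n; s≤s; s≤s⁻¹; _≟_)
open import Data.Nat.Properties using (n<1+n; m≤n⇒m<n∨m≡n; ≤-refl; ≤-trans; n≤1+n; ≤-reflexive;
  +-mono-≤; +-mono-<-≤; +-mono-≤-<; <-≤-trans; suc-injective)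
open import Data.Fin using (Fin; zero; suc; toℕ; fromℕ<; punchOut) renaming (_≟_ to _≟F_)
open import Data.Fin.Properties using (<⇒notInjective; punchOut-injective; toℕ-injective; toℕ-fromℕ<; toℕ<n)
open import Data.List using (List; []; _∷_; _++_; map; allFin)
open import Data.List.Relation.Unary.Any using (here; there; any?; satisfied)
open import Data.List.Membership.Propositional using (_∈_; lose)
open import Data.List.Membership.Propositional.Properties using (∈-map⁺; ∈-++⁺ˡ; ∈-++⁺ʳ; ∈-allFin)
open import Data.Maybe using (Maybe; just; nothing)
open import Data.Maybe.Properties using (just-injective) renaming (≡-dec to ≡-dec-Maybe)
open import Data.Product using (Σ; _×_; _,_; proj₁; proj₂)
open import Data.Sum using (_⊎_; inj₁; inj₂)
open import Data.Unit using (tt)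
open import Data.Empty using (⊥; ⊥-elim)
open import Function using (_∘_)
open import Function.Definitions using (Injective)
open import Relation.Nullary using (¬_; Dec; yes; no; ¬?)
open import Relation.Nullary.Decidable using (map′; _×-dec_)
open import Relation.Binary.Definitions using (DecidableEquality)
open import Relation.Binary.PropositionalEquality using (_≡_; _≢_; refl; sym; trans; cong; subst)
open import Defs

noInjectionMissing : ∀ {n} (i : Fin n) (h : Fin n → Fin n) →
  (∀ x → i ≢ h x) → Injective _≡_ _≡_ h → ⊥
noInjectionMissing {suc n} i h missed h-inj =
  <⇒notInjective {f = λ x → punchOut (missed x)} (n<1+n n)
    (λ eq → h-inj (punchOut-injective (missed _) (missed _) eq))

rangeIndex : ∀ {n c} → 2 ≤ c → c ≤ suc n → Fin n
rangeIndex (s≤s (s≤s _)) (s≤s c<n) = fromℕ< c<n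

rangeIndex-injective : ∀ {n c d} (c≥2 : 2 ≤ c) (c≤ : c ≤ suc n) (d≥2 : 2 ≤ d) (d≤ : d ≤ suc n) →
  rangeIndex c≥2 c≤ ≡ rangeIndex d≥2 d≤ → c ≡ d
rangeIndex-injective (s≤s (s≤s _)) (s≤s c<n) (s≤s (s≤s _)) (s≤s d<n) eq =
  cong (λ m → suc (suc m)) (trans (sym (toℕ-fromℕ< c<n)) (trans (cong toℕ eq) (toℕ-fromℕ< d<n)))

noInjectionIntoRange : ∀ {n} (g : Fin (suc n) → ℕ) → (∀ x → 2 ≤ g x) → (∀ x → g x ≤ suc n) →
  Injective _≡_ _≡_ g → ⊥
noInjectionIntoRange {n} g above below g-inj =
  <⇒notInjective {f = λ x → rangeIndex (above x) (below x)} (n<1+n n)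
    (λ eq → g-inj (rangeIndex-injective (above _) (below _) (above _) (below _) eq))

leastFailure : (K : ℕ) (P : ℕ → Set) → (∀ c → Dec (P c)) →
  (∀ c → 1 ≤ c → c ≤ K → P c) ⊎
  Σ ℕ (λ c → 1 ≤ c × c ≤ K × ¬ P c × (∀ c' → 1 ≤ c' → c' < c → P c'))
leastFailure zero P P? = inj₁ λ { c (s≤s _) () }
leastFailure (suc K) P P? with leastFailure K P P?
... | inj₂ (c , 1≤c , c≤K , ¬Pc , below) = inj₂ (c , 1≤c , ≤-trans c≤K (n≤1+n K) , ¬Pc , below)
... | inj₁ upToK with P? (suc K)
...   | no ¬PK+1 = inj₂ (suc K , s≤s z≤n , ≤-refl , ¬PK+1 , λ c' 1≤c' c'≤K → upToK c' 1≤c' (s≤s⁻¹ c'≤K))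
...   | yes PK+1 = inj₁ λ c 1≤c c≤K+1 → extend c 1≤c (m≤n⇒m<n∨m≡n c≤K+1)
  where
  extend : ∀ c → 1 ≤ c → c < suc K ⊎ c ≡ suc K → P c
  extend c 1≤c (inj₁ c≤K) = upToK c 1≤c (s≤s⁻¹ c≤K)
  extend c 1≤c (inj₂ refl) = PK+1

nothing≢just : ∀ {m : Maybe ℕ} {c} → m ≡ nothing → m ≡ just c → ⊥
nothing≢just refl ()

sameColour : ∀ {m : Maybe ℕ} {a b} → m ≡ just a → m ≡ just b → a ≡ b
sameColour ea eb = just-injective (trans (sym ea) eb)

colourOf : (m : Maybe ℕ) → m ≢ nothing → Σ ℕ λ c → m ≡ just c
colourOf nothing coloured = ⊥-elim (coloured refl)
colourOf (just c) _ = c , refl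

isUncoloured : Maybe ℕ → ℕ
isUncoloured nothing = 1
isUncoloured (just _) = 0

module GreedyGame {V : Set} (Adj : V → V → Set) (K : ℕ)
    (_≟V_ : DecidableEquality V) (adj? : ∀ u v → Dec (Adj u v))
    (adj-sym : ∀ {u v} → Adj u v → Adj v u) (adj-irrefl : ∀ {v} → ¬ Adj v v)
    (vertices : List V) (complete : ∀ v → v ∈ vertices) where

  open Game Adj K public

  someVertex? : (P : V → Set) → (∀ v → Dec (P v)) → Dec (Σ V P)
  someVertex? P P? = map′ satisfied (λ (v , p) → lose (complete v) p) (any? P? vertices)

  used? : ∀ col v c → Dec (Used col v c)
  used? col v c = someVertex? _ (λ u → adj? u v ×-dec ≡-dec-Maybe _≟_ (col u) (just c))

  recolour : Coloring V → V → ℕ → Coloring V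
  recolour col v c u with u ≟V v
  ... | yes _ = just c
  ... | no _ = col u

  recolour-at : ∀ col v c → recolour col v c v ≡ just c
  recolour-at col v c with v ≟V v
  ... | yes _ = refl
  ... | no v≢v = ⊥-elim (v≢v refl)

  recolour-elsewhere : ∀ col v c u → u ≢ v → recolour col v c u ≡ col u
  recolour-elsewhere col v c u u≢v with u ≟V v
  ... | yes u≡v = ⊥-elim (u≢v u≡v)
  ... | no _ = refl

  blockedOrMove : ∀ col v → col v ≡ nothing → Blocked col v ⊎ Σ (Coloring V) (Move col v)
  blockedOrMove col v uncoloured with leastFailure K (Used col v) (used? col v)
  ... | inj₁ allUsed = inj₁ (uncoloured , allUsed)
  ... | inj₂ (c , least) =
    inj₂ (recolour col v c , uncoloured , c , least , recolour-at col v c , recolour-elsewhere col v c)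

  uncolouredOrDone : ∀ col → Σ V (λ v → col v ≡ nothing) ⊎ AllColored col
  uncolouredOrDone col with someVertex? (λ v → col v ≡ nothing) (λ v → ≡-dec-Maybe _≟_ (col v) nothing)
  ... | yes found = inj₁ found
  ... | no none = inj₂ λ v uncoloured → none (v , uncoloured)

  unchanged : ∀ {col v col'} → Move col v col' → ∀ u → u ≢ v → col' u ≡ col u
  unchanged (_ , _ , _ , _ , others) = others

  stays : ∀ {col v col' u c} → Move col v col' → col u ≡ just c → col' u ≡ just c
  stays {v = v} {u = u} mv coloured with u ≟V v
  ... | yes refl = ⊥-elim (nothing≢just (proj₁ mv) coloured)
  ... | no u≢v = trans (unchanged mv u u≢v) coloured

  newOrOld : ∀ {col v col' u c} → Move col v col' → col' u ≡ just c →
    (u ≡ v × LeastFree col v c) ⊎ col u ≡ just c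
  newOrOld {col} {v} {u = u} (_ , _ , least , at , others) coloured with u ≟V v
  ... | yes refl = inj₁ (refl , subst (LeastFree col v) (sameColour at coloured) least)
  ... | no u≢v = inj₂ (trans (sym (others u u≢v)) coloured)

  leastFree-unused : ∀ {col v c} → LeastFree col v c → ¬ Used col v c
  leastFree-unused (_ , _ , unused , _) = unused

  firstColour : ∀ {col v col'} → Move col v col' → ¬ Used col v 1 → col' v ≡ just 1
  firstColour {col} {v} (_ , c , least , at , _) free = trans at (cong just (isOne c least))
    where
    isOne : ∀ c → LeastFree col v c → c ≡ 1
    isOne (suc zero) _ = refl
    isOne (suc (suc c)) (_ , _ , _ , below) = ⊥-elim (free (below 1 (s≤s z≤n) (s≤s (s≤s z≤n))))

  uncolouredCount : Coloring V → List V → ℕ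
  uncolouredCount col [] = 0
  uncolouredCount col (u ∷ us) = isUncoloured (col u) + uncolouredCount col us

  move-monotone : ∀ {col v col'} → Move col v col' → ∀ u → isUncoloured (col' u) ≤ isUncoloured (col u)
  move-monotone {v = v} mv@(_ , _ , _ , at , _) u with u ≟V v
  ... | yes refl rewrite at = z≤n
  ... | no u≢v = ≤-reflexive (cong isUncoloured (unchanged mv u u≢v))

  move-colours : ∀ {col v col'} → Move col v col' → isUncoloured (col' v) < isUncoloured (col v)
  move-colours (uncoloured , _ , _ , at , _) rewrite uncoloured | at = s≤s z≤n

  count-monotone : ∀ {col v col'} → Move col v col' → ∀ us → uncolouredCount col' us ≤ uncolouredCount col us
  count-monotone mv [] = z≤n
  count-monotone mv (u ∷ us) = +-mono-≤ (move-monotone mv u) (count-monotone mv us)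

  count-decreases : ∀ {col v col' us} → Move col v col' → v ∈ us →
    uncolouredCount col' us < uncolouredCount col us
  count-decreases {us = _ ∷ us} mv (here refl) = +-mono-<-≤ (move-colours mv) (count-monotone mv us)
  count-decreases {us = u ∷ _} mv (there v∈us) = +-mono-≤-< (move-monotone mv u) (count-decreases mv v∈us)

  shrinks : ∀ {col v col' n} → Move col v col' → uncolouredCount col vertices < suc n →
    uncolouredCount col' vertices < n
  shrinks {v = v} mv bound = <-≤-trans (count-decreases mv (complete v)) (s≤s⁻¹ bound)

  aliceWinsWhile : (I : Coloring V → Set) → (∀ {col v col'} → Move col v col' → I col → I col') →
    (∀ {col} → I col → ¬ BobWon col) → ∀ col → I col → ∀ p → AliceWins col p
  aliceWinsWhile I preserved safe col inv p = go _ col (n<1+n _) inv p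
    where
    go : ∀ n col → uncolouredCount col vertices < n → I col → ∀ p → AliceWins col p
    go (suc n) col bound inv alice with uncolouredOrDone col
    ... | inj₂ done = a-done done
    ... | inj₁ (v , uncoloured) with blockedOrMove col v uncoloured
    ...   | inj₁ blocked = ⊥-elim (safe inv (v , blocked))
    ...   | inj₂ (col' , mv) =
      a-alice (safe inv) (v , col' , mv , go n col' (shrinks mv bound) (preserved mv inv) bob)
    go (suc n) col bound inv bob =
      a-bob (safe inv) λ v col' mv → go n col' (shrinks mv bound) (preserved mv inv) alice

  bobWinsWhile : (I : Coloring V → Set) → (∀ {col v col'} → Move col v col' → I col → I col') →
    (∀ {col} → I col → ¬ AllColored col) → ∀ col → I col → ∀ p → BobWins col p
  bobWinsWhile I preserved unfinished col inv p = go _ col (n<1+n _) inv p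
    where
    go : ∀ n col → uncolouredCount col vertices < n → I col → ∀ p → BobWins col p
    go (suc n) col bound inv bob with uncolouredOrDone col
    ... | inj₂ done = ⊥-elim (unfinished inv done)
    ... | inj₁ (v , uncoloured) with blockedOrMove col v uncoloured
    ...   | inj₁ blocked = b-done (v , blocked)
    ...   | inj₂ (col' , mv) =
      b-bob (unfinished inv) (v , col' , mv , go n col' (shrinks mv bound) (preserved mv inv) alice)
    go (suc n) col bound inv alice =
      b-alice (unfinished inv) λ v col' mv → go n col' (shrinks mv bound) (preserved mv inv) bob

  Pinned : V → V → Coloring V → Set
  Pinned a b col = col a ≡ just 1 × col b ≡ just 1

  pinned-preserved : ∀ {a b col v col'} → Move col v col' → Pinned a b col → Pinned a b col'
  pinned-preserved mv (a₁ , b₁) = stays mv a₁ , stays mv b₁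

  Proper : Coloring V → Set
  Proper col = ∀ {u v c} → Adj u v → col u ≡ just c → col v ≡ just c → ⊥

  InRange : Coloring V → Set
  InRange col = ∀ {u c} → col u ≡ just c → 1 ≤ c × c ≤ K

  Greedy : Coloring V → Set
  Greedy col = Proper col × InRange col

  greedy-empty : Greedy empty
  greedy-empty = (λ _ ()) , λ ()

  proper-preserved : ∀ {col v col'} → Move col v col' → Proper col → Proper col'
  proper-preserved mv proper {u} {u'} adj cu cu' with newOrOld mv cu | newOrOld mv cu'
  ... | inj₁ (refl , _) | inj₁ (refl , _) = adj-irrefl adj
  ... | inj₁ (refl , least) | inj₂ old' = leastFree-unused least (u' , adj-sym adj , old')
  ... | inj₂ old | inj₁ (refl , least) = leastFree-unused least (u , adj , old)
  ... | inj₂ old | inj₂ old' = proper adj old old'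

  inRange-preserved : ∀ {col v col'} → Move col v col' → InRange col → InRange col'
  inRange-preserved mv inRange coloured with newOrOld mv coloured
  ... | inj₁ (_ , 1≤c , c≤K , _) = 1≤c , c≤K
  ... | inj₂ old = inRange old

  greedy-preserved : ∀ {col v col'} → Move col v col' → Greedy col → Greedy col'
  greedy-preserved mv (proper , inRange) = proper-preserved mv proper , inRange-preserved mv inRange

module F3 (k : ℕ) where

  clq-injective : ∀ {i j : Fin k} → clq {k} i ≡ clq j → i ≡ j
  clq-injective refl = refl

  _≟V_ : DecidableEquality (F3V k)
  clq i ≟V clq j = map′ (cong clq) clq-injective (i ≟F j)
  clq _ ≟V s = no λ ()
  clq _ ≟V y = no λ ()
  clq _ ≟V w = no λ ()
  s ≟V clq _ = no λ ()
  s ≟V s = yes refl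
  s ≟V y = no λ ()
  s ≟V w = no λ ()
  y ≟V clq _ = no λ ()
  y ≟V s = no λ ()
  y ≟V y = yes refl
  y ≟V w = no λ ()
  w ≟V clq _ = no λ ()
  w ≟V s = no λ ()
  w ≟V y = no λ ()
  w ≟V w = yes refl

  adj? : ∀ u v → Dec (F3Adj k u v)
  adj? (clq i) (clq j) = ¬? (i ≟F j)
  adj? (clq _) s = yes tt
  adj? (clq _) y = yes tt
  adj? (clq _) w = no λ ()
  adj? s (clq _) = yes tt
  adj? s s = no λ ()
  adj? s y = no λ ()
  adj? s w = no λ ()
  adj? y (clq _) = yes tt
  adj? y s = no λ ()
  adj? y y = no λ ()
  adj? y w = yes tt
  adj? w (clq _) = no λ ()
  adj? w s = no λ ()
  adj? w y = yes tt
  adj? w w = no λ ()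

  -- Omitted cases are absurd: their adjacency type reduces to ⊥.
  adj-sym : ∀ {u v} → F3Adj k u v → F3Adj k v u
  adj-sym {clq _} {clq _} i≢j = i≢j ∘ sym
  adj-sym {clq _} {s} _ = tt
  adj-sym {clq _} {y} _ = tt
  adj-sym {s} {clq _} _ = tt
  adj-sym {y} {clq _} _ = tt
  adj-sym {y} {w} _ = tt
  adj-sym {w} {y} _ = tt

  adj-irrefl : ∀ {v} → ¬ F3Adj k v v
  adj-irrefl {clq _} i≢i = i≢i refl

  vertices : List (F3V k)
  vertices = map clq (allFin k) ++ s ∷ y ∷ w ∷ []

  complete : ∀ v → v ∈ vertices
  complete (clq i) = ∈-++⁺ˡ (∈-map⁺ clq (∈-allFin i))
  complete s = ∈-++⁺ʳ (map clq (allFin k)) (here refl)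
  complete y = ∈-++⁺ʳ (map clq (allFin k)) (there (here refl))
  complete w = ∈-++⁺ʳ (map clq (allFin k)) (there (there (here refl)))

  open GreedyGame (F3Adj k) (suc k) _≟V_ adj? adj-sym adj-irrefl vertices complete public

  cliqueWitness : ∀ {col i c} → Pinned s y col → Used col (clq i) (suc (suc c)) →
    Σ (Fin k) λ j → i ≢ j × col (clq j) ≡ just (suc (suc c))
  cliqueWitness _ (clq j , j≢i , coloured) = j , j≢i ∘ sym , coloured
  cliqueWitness (s₁ , _) (s , _ , coloured) with sameColour s₁ coloured
  ... | ()
  cliqueWitness (_ , y₁) (y , _ , coloured) with sameColour y₁ coloured
  ... | ()

  -- Blocking clq i would need the k colours 2,…,k+1 on the k-1 other clique vertices.
  cliqueNotBlocked : ∀ {col i} → Pinned s y col → ¬ Blocked col (clq i)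
  cliqueNotBlocked {col} {i} pinned (_ , allUsed) = noInjectionMissing i holder avoids holder-injective
    where
    witness : ∀ x → Σ (Fin k) λ j → i ≢ j × col (clq j) ≡ just (suc (suc (toℕ x)))
    witness x = cliqueWitness pinned (allUsed (suc (suc (toℕ x))) (s≤s z≤n) (s≤s (toℕ<n x)))

    holder : Fin k → Fin k
    holder x = proj₁ (witness x)

    avoids : ∀ x → i ≢ holder x
    avoids x = proj₁ (proj₂ (witness x))

    holder-injective : Injective _≡_ _≡_ holder
    holder-injective {x} {x'} same = toℕ-injective (suc-injective (suc-injective
      (sameColour (proj₂ (proj₂ (witness x)))
                  (subst (λ j → col (clq j) ≡ _) (sym same) (proj₂ (proj₂ (witness x')))))))

  -- w's only neighbour y has colour 1, so colour 2 is free for w.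
  wNotBlocked : ∀ {col} → 1 ≤ k → Pinned s y col → ¬ Blocked col w
  wNotBlocked k≥1 (_ , y₁) (_ , allUsed) with allUsed 2 (s≤s z≤n) (s≤s k≥1)
  ... | y , _ , coloured with sameColour y₁ coloured
  ...   | ()

  aliceSafe : ∀ {col} → 1 ≤ k → Pinned s y col → ¬ BobWon col
  aliceSafe _ (s₁ , _) (s , uncoloured , _) = nothing≢just uncoloured s₁
  aliceSafe _ (_ , y₁) (y , uncoloured , _) = nothing≢just uncoloured y₁
  aliceSafe k≥1 pinned (w , blocked) = wNotBlocked k≥1 pinned blocked
  aliceSafe _ pinned (clq _ , blocked) = cliqueNotBlocked pinned blocked

  BobInvariant : Coloring (F3V k) → Set
  BobInvariant col = Pinned s w col × Greedy col

  bigClique : Fin (suc k) → F3V k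
  bigClique zero = y
  bigClique (suc i) = clq i

  bigClique-adjacent : ∀ {x x'} → x ≢ x' → F3Adj k (bigClique x) (bigClique x')
  bigClique-adjacent {zero} {zero} x≢x' = x≢x' refl
  bigClique-adjacent {zero} {suc _} _ = tt
  bigClique-adjacent {suc _} {zero} _ = tt
  bigClique-adjacent {suc _} {suc _} x≢x' = x≢x' ∘ cong suc

  anchor : Fin (suc k) → F3V k
  anchor zero = w
  anchor (suc _) = s

  anchor-adjacent : ∀ x → F3Adj k (anchor x) (bigClique x)
  anchor-adjacent zero = tt
  anchor-adjacent (suc _) = tt

  anchor-pinned : ∀ {col} → Pinned s w col → ∀ x → col (anchor x) ≡ just 1
  anchor-pinned (_ , w₁) zero = w₁
  anchor-pinned (s₁ , _) (suc _) = s₁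

  atLeastTwo : ∀ {c} → 1 ≤ c → c ≢ 1 → 2 ≤ c
  atLeastTwo {suc zero} _ c≢1 = ⊥-elim (c≢1 refl)
  atLeastTwo {suc (suc _)} _ _ = s≤s (s≤s z≤n)

  -- A complete colouring would give the big clique k+1 distinct colours among 2,…,k+1.
  bobSafe : ∀ {col} → BobInvariant col → ¬ AllColored col
  bobSafe {col} (pinned , proper , inRange) allColoured =
    noInjectionIntoRange colour aboveOne (λ x → proj₂ (inRange (colour-correct x))) colour-injective
    where
    colour : Fin (suc k) → ℕ
    colour x = proj₁ (colourOf (col (bigClique x)) (allColoured (bigClique x)))

    colour-correct : ∀ x → col (bigClique x) ≡ just (colour x)
    colour-correct x = proj₂ (colourOf (col (bigClique x)) (allColoured (bigClique x)))

    aboveOne : ∀ x → 2 ≤ colour x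
    aboveOne x = atLeastTwo (proj₁ (inRange (colour-correct x))) λ is1 →
      proper (anchor-adjacent x) (anchor-pinned {col} pinned x)
        (subst (λ c → col (bigClique x) ≡ just c) is1 (colour-correct x))

    colour-injective : Injective _≡_ _≡_ colour
    colour-injective {x} {x'} same with x ≟F x'
    ... | yes x≡x' = x≡x'
    ... | no x≢x' = ⊥-elim (proper (bigClique-adjacent x≢x') (colour-correct x)
                              (subst (λ c → col (bigClique x') ≡ just c) (sym same) (colour-correct x')))

  Opened : Coloring (F3V k) → Set
  Opened col = col s ≡ just 1 × (∀ u → u ≢ s → col u ≡ nothing)

  opening : ∀ {col} → Move empty s col → Opened col
  opening mv = firstColour mv (λ (_ , _ , coloured) → nothing≢just refl coloured) , unchanged mv

  unseenAfterOpening : ∀ {col v c} → Opened col → ¬ F3Adj k s v → ¬ Used col v c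
  unseenAfterOpening _ notAdj (s , adj , _) = notAdj adj
  unseenAfterOpening (_ , rest) _ (clq _ , _ , coloured) = nothing≢just (rest _ λ ()) coloured
  unseenAfterOpening (_ , rest) _ (y , _ , coloured) = nothing≢just (rest y λ ()) coloured
  unseenAfterOpening (_ , rest) _ (w , _ , coloured) = nothing≢just (rest w λ ()) coloured

  wUnseen : ∀ {col c} → col y ≡ nothing → ¬ Used col w c
  wUnseen y-uncoloured (y , _ , coloured) = nothing≢just y-uncoloured coloured

  aliceWinsFrom : ∀ {col} → 1 ≤ k → Pinned s y col → ∀ p → AliceWins col p
  aliceWinsFrom k≥1 = aliceWinsWhile (Pinned s y) pinned-preserved (aliceSafe k≥1) _

  bobPreserved : ∀ {col v col'} → Move col v col' → BobInvariant col → BobInvariant col'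
  bobPreserved mv (pinned , greedy) = pinned-preserved mv pinned , greedy-preserved mv greedy

  bobWinsFrom : ∀ {col} → BobInvariant col → ∀ p → BobWins col p
  bobWinsFrom = bobWinsWhile BobInvariant bobPreserved bobSafe _

  aliceAnswersY : ∀ {col₁ col₂} → 1 ≤ k → Opened col₁ → Move col₁ y col₂ → AliceWins col₂ bob
  aliceAnswersY k≥1 opened@(s₁ , _) mv =
    aliceWinsFrom k≥1 (stays mv s₁ , firstColour mv (unseenAfterOpening opened λ ())) bob

  -- Once Alice has coloured a clique vertex, Bob colours w with 1 and reaches his invariant.
  bobAnswersW : ∀ {col} → col s ≡ just 1 → Greedy col → col y ≡ nothing → col w ≡ nothing →
    BobWins col bob
  bobAnswersW {col} s₁ greedy y-uncoloured w-uncoloured with blockedOrMove col w w-uncoloured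
  ... | inj₁ blocked = b-done (w , blocked)
  ... | inj₂ (col' , mv) = b-bob (λ done → done w w-uncoloured) (w , col' , mv ,
          bobWinsFrom ((stays mv s₁ , firstColour mv (wUnseen y-uncoloured)) , greedy-preserved mv greedy) alice)

  bobPunishes : ∀ {col₁ v col₂} → Opened col₁ → Greedy col₁ → v ≢ y → Move col₁ v col₂ → BobWins col₂ bob
  bobPunishes {v = s} (s₁ , _) _ _ mv = ⊥-elim (nothing≢just (proj₁ mv) s₁)
  bobPunishes {v = y} _ _ v≢y _ = ⊥-elim (v≢y refl)
  bobPunishes {v = w} opened@(s₁ , _) greedy _ mv =
    bobWinsFrom ((stays mv s₁ , firstColour mv (unseenAfterOpening opened λ ())) , greedy-preserved mv greedy) bob
  bobPunishes {v = clq _} (s₁ , rest) greedy _ mv =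
    bobAnswersW (stays mv s₁) (greedy-preserved mv greedy)
      (trans (unchanged mv y λ ()) (rest y λ ())) (trans (unchanged mv w λ ()) (rest w λ ()))

lemma4 : (k : ℕ) → 1 ≤ k →
    let open Game (F3Adj k) (suc k) in
    (col₁ : Coloring (F3V k)) → Move empty s col₁ →
    ((col₂ : Coloring (F3V k)) → Move col₁ y col₂ → AliceWins col₂ bob)
    × ((v : F3V k) → ¬ v ≡ y → (col₂ : Coloring (F3V k)) → Move col₁ v col₂ → BobWins col₂ bob)
lemma4 k k≥1 col₁ first =
    (λ col₂ answer → aliceAnswersY k≥1 opened answer)
  , (λ v v≢y col₂ answer → bobPunishes opened (greedy-preserved first greedy-empty) v≢y answer)
  where
  open F3 k
  opened : Opened col₁
  opened = opening first
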